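{- Let $k>1$ be an integer and let $M_k$ be a matching with $k$ edges. Then $\mathrm{ex}(n,M_k,\textup{rainbow- }M_k)=\Theta(n^k)$ as $n\to\infty$.
   Context: A matching with $k$ edges is the graph consisting of $k$ pairwise vertex-disjoint edges. An edge-coloring is proper if any two edges sharing a vertex receive different colors. A subgraph of an edge-colored graph is rainbow if all its edges have distinct colors. For graphs $H$ and $F$, $\mathrm{ex}(n,H,\textup{rainbow- }F)$ denotes the maximum number of copies of $H$ (subgraphs isomorphic to $H$) in a graph $G$ on $n$ vertices equipped with a proper edge-coloring in which there is no rainbow copy of $F$. -}

module Defs where

open import Data.Nat using (ℕ; zero; suc; _≡ᵇ_; _<ᵇ_)
open import Data.Fin using (Fin; toℕ)
open import Data.Bool using (Bool; true; false; _∧_; not; if_then_else_; T)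
open import Data.List using (List; []; _∷_; concatMap; map; foldr)
open import Data.Nat.ListAction using (sum)
open import Data.List.Base using (allFin)
open import Data.Vec using (Vec; []; _∷_; toList)
open import Data.Product using (_×_; _,_; proj₁; proj₂; Σ)
open import Relation.Binary.PropositionalEquality using (_≡_; _≢_)
open import Relation.Nullary using (¬_)

record Graph (n : ℕ) : Set where
  field
    adj    : Fin n → Fin n → Bool
    adj-sym    : ∀ u v → adj u v ≡ adj v u
    adj-irrefl : ∀ u → adj u u ≡ false
open Graph public

-- An edge-colouring assigns a colour (a natural number) to each edge uv;
-- values on non-edges are irrelevant.
Colouring : ℕ → Set
Colouring n = Fin n → Fin n → ℕ

Proper : ∀ {n} → Graph n → Colouring n → Set
Proper {n} G c =
  (∀ u v → adj G u v ≡ true → c u v ≡ c v u) ×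
  (∀ u v w → adj G u v ≡ true → adj G u w ≡ true → v ≢ w → c u v ≢ c u w)

EdgeTuple : ℕ → ℕ → Set
EdgeTuple n k = Vec (Fin n × Fin n) k

private
  eqF : ∀ {n} → Fin n → Fin n → Bool
  eqF a b = toℕ a ≡ᵇ toℕ b

  ltF : ∀ {n} → Fin n → Fin n → Bool
  ltF a b = toℕ a <ᵇ toℕ b

allB : ∀ {A : Set} → (A → Bool) → List A → Bool
allB p = foldr (λ x r → p x ∧ r) true

pairwiseB : ∀ {A : Set} {k} → (A → A → Bool) → Vec A k → Bool
pairwiseB R [] = true
pairwiseB R (p ∷ ps) = allB (R p) (toList ps) ∧ pairwiseB R ps

disjointB : ∀ {n} → Fin n × Fin n → Fin n × Fin n → Bool
disjointB (a , b) (c , d) =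
  not (eqF a c) ∧ not (eqF a d) ∧ not (eqF b c) ∧ not (eqF b d)

allEdgesB : ∀ {n k} → Graph n → EdgeTuple n k → Bool
allEdgesB G m = allB (λ p → adj G (proj₁ p) (proj₂ p)) (toList m)

matchingB : ∀ {n k} → Graph n → EdgeTuple n k → Bool
matchingB G m = allEdgesB G m ∧ pairwiseB disjointB m

rainbowB : ∀ {n k} → Colouring n → EdgeTuple n k → Bool
rainbowB c m = pairwiseB (λ p q → not (c (proj₁ p) (proj₂ p) ≡ᵇ c (proj₁ q) (proj₂ q))) m

-- canonical representation of an (unordered) set of k disjoint edges:
-- each edge written as (a , b) with a < b, and edges sorted by strictly
-- increasing smaller endpoint. Each copy of M_k has exactly one such tuple.
canonicalB : ∀ {n k} → EdgeTuple n k → Bool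
canonicalB m = allB (λ p → ltF (proj₁ p) (proj₂ p)) (toList m)
             ∧ pairwiseB (λ p q → ltF (proj₁ p) (proj₁ q)) m

allPairs : ∀ n → List (Fin n × Fin n)
allPairs n = concatMap (λ a → map (a ,_) (allFin n)) (allFin n)

allTuples : ∀ n k → List (EdgeTuple n k)
allTuples n zero = [] ∷ []
allTuples n (suc k) = concatMap (λ p → map (p ∷_) (allTuples n k)) (allPairs n)

copiesMatching : ∀ {n} → ℕ → Graph n → ℕ
copiesMatching {n} k G =
  sum (map (λ m → if matchingB G m ∧ canonicalB m then 1 else 0) (allTuples n k))

NoRainbowMatching : ∀ {n} → ℕ → Graph n → Colouring n → Set
NoRainbowMatching {n} k G c =
  ¬ Σ (EdgeTuple n k) (λ m → T (matchingB G m) × T (rainbowB c m))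

-- Upper bound: greedily extend a rainbow matching by edges disjoint from it and of a new
-- colour. Without a rainbow M_k this gets stuck at a rainbow matching R with fewer than k
-- edges, and then every edge of G meets an edge q of R or has the colour of q. For each q
-- at most 5n ordered vertex pairs do so: four endpoint conditions, and properness leaves
-- at most one edge of the colour of q at each vertex. Hence G has at most 5kn edges and at
-- most (5kn)^k copies of M_k.
--
-- Lower bound: with B = ⌊n/2k⌋ and D = kB, the D disjoint edges {x, x + D} (x < D), all of
-- colour 0, form a properly coloured graph in which no two edges have distinct colours.
-- Cutting the edges into k blocks of B consecutive ones and picking one edge per block
-- gives B^k ≥ (n/4k)^k copies of M_k.

module Submission where

open import Defs
open import Data.Bool using (Bool; true; false; _∧_; _∨_; not; if_then_else_; T)
open import Data.Bool.Properties using (∨-comm; not-involutive; T-∧; T-∨; T-≡)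
open import Data.Empty using (⊥; ⊥-elim)
open import Data.Fin as Fin using (Fin; toℕ)
import Data.Fin.Properties as Finₚ
open import Data.List using (List; []; _∷_; _++_; map; concatMap; tabulate)
open import Data.List.Base using (allFin)
open import Data.List.Relation.Unary.All as All using (All; []; _∷_)
open import Data.List.Relation.Unary.AllPairs using ([]; _∷_)
open import Data.List.Relation.Unary.Unique.Propositional using (Unique)
open import Data.List.Relation.Unary.Unique.Propositional.Properties using (allFin⁺)
open import Data.Nat using (ℕ; zero; suc; _+_; _*_; _^_; _≤_; _<_; z≤n; s≤s; NonZero; >-nonZero; _≡ᵇ_; _<ᵇ_; _≤ᵇ_; _/_; _%_)
open import Data.Nat.DivMod using (m≡m%n+[m/n]*n; m%n<n; m/n*n≤m; m≥n⇒m/n>0)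
open import Data.Nat.ListAction using (sum)
open import Data.Nat.Properties
open import Data.Nat.Tactic.RingSolver using (solve-∀)
open import Data.Product using (Σ; _×_; _,_; proj₁; proj₂)
open import Data.Sum using (_⊎_; inj₁; inj₂)
open import Data.Unit using (⊤; tt)
open import Data.Vec using (Vec; []; _∷_; toList)
open import Function using (_∘_)
open import Function.Bundles using (Equivalence)
open import Relation.Binary.PropositionalEquality
open import Relation.Nullary using (¬_; Dec; yes; no)
open import Relation.Nullary.Decidable using (T?; _×-dec_)

open Equivalence using (to; from)

𝟙 : Bool → ℕ
𝟙 b = if b then 1 else 0

𝟙-∧ : ∀ x y → 𝟙 (x ∧ y) ≡ 𝟙 x * 𝟙 y
𝟙-∧ true  y = sym (*-identityˡ (𝟙 y))
𝟙-∧ false y = refl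

𝟙-mono : ∀ {x y} → (T x → T y) → 𝟙 x ≤ 𝟙 y
𝟙-mono {false}         _   = z≤n
𝟙-mono {true} {true}   _   = ≤-refl
𝟙-mono {true} {false} x⇒y = ⊥-elim (x⇒y tt)

T⇒𝟙≡1 : ∀ {x} → T x → 𝟙 x ≡ 1
T⇒𝟙≡1 {true} _ = refl

¬T⇒≡false : ∀ {x} → ¬ T x → x ≡ false
¬T⇒≡false {false} _  = refl
¬T⇒≡false {true}  ¬t = ⊥-elim (¬t tt)

𝟙-not-∧-not : ∀ x y z w → 𝟙 (not (not x ∧ not y ∧ not z ∧ not w)) ≤ (𝟙 x + 𝟙 y) + (𝟙 z + 𝟙 w)
𝟙-not-∧-not true  y     z     w     = s≤s z≤n
𝟙-not-∧-not false true  z     w     = s≤s z≤n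
𝟙-not-∧-not false false true  w     = s≤s z≤n
𝟙-not-∧-not false false false true  = s≤s z≤n
𝟙-not-∧-not false false false false = z≤n

sumOver : ∀ {A : Set} → (A → ℕ) → List A → ℕ
sumOver f []       = 0
sumOver f (x ∷ xs) = f x + sumOver f xs

syntax sumOver (λ x → e) xs = ∑[ x ∈ xs ] e

module _ {A : Set} where

  sum-map : ∀ (f : A → ℕ) xs → sum (map f xs) ≡ sumOver f xs
  sum-map f []       = refl
  sum-map f (x ∷ xs) = cong (f x +_) (sum-map f xs)

  sumOver-mono : ∀ {f g : A → ℕ} → (∀ x → f x ≤ g x) → ∀ xs → sumOver f xs ≤ sumOver g xs
  sumOver-mono f≤g []       = z≤n
  sumOver-mono f≤g (x ∷ xs) = +-mono-≤ (f≤g x) (sumOver-mono f≤g xs)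

  sumOver-cong : ∀ {f g : A → ℕ} → (∀ x → f x ≡ g x) → ∀ xs → sumOver f xs ≡ sumOver g xs
  sumOver-cong f≡g []       = refl
  sumOver-cong f≡g (x ∷ xs) = cong₂ _+_ (f≡g x) (sumOver-cong f≡g xs)

  sumOver-zero : ∀ (xs : List A) → ∑[ x ∈ xs ] 0 ≡ 0
  sumOver-zero []       = refl
  sumOver-zero (x ∷ xs) = sumOver-zero xs

  sumOver-++ : ∀ (f : A → ℕ) xs ys → sumOver f (xs ++ ys) ≡ sumOver f xs + sumOver f ys
  sumOver-++ f []       ys = refl
  sumOver-++ f (x ∷ xs) ys = trans (cong (f x +_) (sumOver-++ f xs ys)) (sym (+-assoc (f x) _ _))

  sumOver-+ : ∀ (f g : A → ℕ) xs → ∑[ x ∈ xs ] (f x + g x) ≡ sumOver f xs + sumOver g xs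
  sumOver-+ f g []       = refl
  sumOver-+ f g (x ∷ xs) = trans (cong (f x + g x +_) (sumOver-+ f g xs)) (+-interchange (f x) (g x) _ _)
    where
    +-interchange : ∀ a b c d → (a + b) + (c + d) ≡ (a + c) + (b + d)
    +-interchange = solve-∀

  sumOver-*ˡ : ∀ (f : A → ℕ) c xs → ∑[ x ∈ xs ] (c * f x) ≡ c * sumOver f xs
  sumOver-*ˡ f c []       = sym (*-zeroʳ c)
  sumOver-*ˡ f c (x ∷ xs) = trans (cong (c * f x +_) (sumOver-*ˡ f c xs)) (sym (*-distribˡ-+ c (f x) _))

  sumOver-*ʳ : ∀ (f : A → ℕ) c xs → ∑[ x ∈ xs ] (f x * c) ≡ sumOver f xs * c
  sumOver-*ʳ f c []       = refl
  sumOver-*ʳ f c (x ∷ xs) = trans (cong (f x * c +_) (sumOver-*ʳ f c xs)) (sym (*-distribʳ-+ c (f x) _))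

  sumOver-toList-const : ∀ {ℓ} c (v : Vec A ℓ) → ∑[ x ∈ toList v ] c ≡ ℓ * c
  sumOver-toList-const c []      = refl
  sumOver-toList-const c (x ∷ v) = cong (c +_) (sumOver-toList-const c v)

  sumOver-violations : ∀ (f g : A → Bool) xs → ¬ (T (allB f xs) × T (allB g xs)) →
                       1 ≤ ∑[ x ∈ xs ] (𝟙 (not (f x)) + 𝟙 (not (g x)))
  sumOver-violations f g []       ¬both = ⊥-elim (¬both (tt , tt))
  sumOver-violations f g (x ∷ xs) ¬both with f x | g x
  ... | false | _     = s≤s z≤n
  ... | true  | false = s≤s z≤n
  ... | true  | true  = ≤-trans (sumOver-violations f g xs ¬both) (m≤n+m _ _)

  sumOver-𝟙-none : ∀ (P : A → Bool) {xs} → All (λ x → ¬ T (P x)) xs → sumOver (𝟙 ∘ P) xs ≡ 0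
  sumOver-𝟙-none P []                 = refl
  sumOver-𝟙-none P {x ∷ _} (¬Px ∷ ¬P) with P x
  ... | false = sumOver-𝟙-none P ¬P
  ... | true  = ⊥-elim (¬Px tt)

  sumOver-𝟙-atMostOne : ∀ (P : A → Bool) {xs} → Unique xs →
                        (∀ {x y} → T (P x) → T (P y) → x ≡ y) → sumOver (𝟙 ∘ P) xs ≤ 1
  sumOver-𝟙-atMostOne P [] _ = z≤n
  sumOver-𝟙-atMostOne P {x ∷ _} (x∉xs ∷ unique) P-unique with P x in Px
  ... | false = sumOver-𝟙-atMostOne P unique P-unique
  ... | true  = ≤-reflexive (cong suc (sumOver-𝟙-none P (All.map (λ x≢y Py → x≢y (P-unique Px′ Py)) x∉xs)))
    where
    Px′ : T (P x)
    Px′ = subst T (sym Px) tt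

module _ {A B : Set} where

  sumOver-map : ∀ (f : B → ℕ) (g : A → B) xs → sumOver f (map g xs) ≡ sumOver (f ∘ g) xs
  sumOver-map f g []       = refl
  sumOver-map f g (x ∷ xs) = cong (f (g x) +_) (sumOver-map f g xs)

  sumOver-concatMap : ∀ (f : B → ℕ) (g : A → List B) xs →
                      sumOver f (concatMap g xs) ≡ ∑[ x ∈ xs ] sumOver f (g x)
  sumOver-concatMap f g []       = refl
  sumOver-concatMap f g (x ∷ xs) =
    trans (sumOver-++ f (g x) (concatMap g xs)) (cong (sumOver f (g x) +_) (sumOver-concatMap f g xs))

  sumOver-comm : ∀ (f : A → B → ℕ) xs ys → ∑[ x ∈ xs ] ∑[ y ∈ ys ] f x y ≡ ∑[ y ∈ ys ] ∑[ x ∈ xs ] f x y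
  sumOver-comm f []       ys = sym (sumOver-zero ys)
  sumOver-comm f (x ∷ xs) ys =
    trans (cong (sumOver (f x) ys +_) (sumOver-comm f xs ys)) (sym (sumOver-+ (f x) _ ys))

sumBelow : ℕ → (ℕ → ℕ) → ℕ
sumBelow zero    f = 0
sumBelow (suc n) f = f 0 + sumBelow n (f ∘ suc)

sumBelow-term : ∀ n (f : ℕ → ℕ) {t} → t < n → f t ≤ sumBelow n f
sumBelow-term (suc n) f {zero}  _         = m≤m+n _ _
sumBelow-term (suc n) f {suc t} (s≤s t<n) = ≤-trans (sumBelow-term n (f ∘ suc) t<n) (m≤n+m _ _)

sumBelow-interval : ∀ n lo m (f : ℕ → ℕ) → lo + m ≤ n → (∀ j → j < m → 1 ≤ f (lo + j)) → m ≤ sumBelow n f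
sumBelow-interval n       zero     zero    f _         _   = z≤n
sumBelow-interval zero    zero     (suc m) f ()        _
sumBelow-interval zero    (suc lo) m       f ()        _
sumBelow-interval (suc n) zero     (suc m) f (s≤s le) pos =
  +-mono-≤ (pos 0 (s≤s z≤n)) (sumBelow-interval n zero m (f ∘ suc) le (λ j j<m → pos (suc j) (s≤s j<m)))
sumBelow-interval (suc n) (suc lo) m       f (s≤s le) pos =
  ≤-trans (sumBelow-interval n lo m (f ∘ suc) le pos) (m≤n+m _ _)

sumBelow-const : ∀ n c → sumBelow n (λ _ → c) ≡ n * c
sumBelow-const zero    c = refl
sumBelow-const (suc n) c = cong (c +_) (sumBelow-const n c)

sumOver-tabulate : ∀ {A : Set} n (g : Fin n → A) (h : A → ℕ) (f : ℕ → ℕ) →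
                   (∀ i → h (g i) ≡ f (toℕ i)) → sumOver h (tabulate g) ≡ sumBelow n f
sumOver-tabulate zero    g h f h∘g≡f = refl
sumOver-tabulate (suc n) g h f h∘g≡f =
  cong₂ _+_ (h∘g≡f Fin.zero) (sumOver-tabulate n (g ∘ Fin.suc) h (f ∘ suc) (h∘g≡f ∘ Fin.suc))

sumOver-allFin : ∀ n (f : ℕ → ℕ) → ∑[ i ∈ allFin n ] f (toℕ i) ≡ sumBelow n f
sumOver-allFin n f = sumOver-tabulate n (λ i → i) (f ∘ toℕ) f (λ _ → refl)

∑² : ∀ {n} → (Fin n → Fin n → ℕ) → ℕ
∑² {n} f = ∑[ a ∈ allFin n ] ∑[ b ∈ allFin n ] f a b

module _ {n : ℕ} where

  ∑²-+-≤ : ∀ (f g : Fin n → Fin n → ℕ) {x y} → ∑² f ≤ x → ∑² g ≤ y → ∑² (λ a b → f a b + g a b) ≤ x + y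
  ∑²-+-≤ f g {x} {y} f≤x g≤y = begin
    ∑² (λ a b → f a b + g a b)
      ≡⟨ sumOver-cong (λ a → sumOver-+ (f a) (g a) (allFin n)) (allFin n) ⟩
    ∑[ a ∈ allFin n ] (sumOver (f a) (allFin n) + sumOver (g a) (allFin n))
      ≡⟨ sumOver-+ _ _ (allFin n) ⟩
    ∑² f + ∑² g
      ≤⟨ +-mono-≤ f≤x g≤y ⟩
    x + y ∎
    where open ≤-Reasoning

  ∑²-transpose : ∀ (f : Fin n → Fin n → ℕ) → ∑² f ≡ ∑² (λ a b → f b a)
  ∑²-transpose f = sumOver-comm f (allFin n) (allFin n)

  ∑²-rows≤ : ∀ (f : Fin n → Fin n → ℕ) {r} → (∀ a → sumOver (f a) (allFin n) ≤ r) → ∑² f ≤ n * r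
  ∑²-rows≤ f {r} rows≤r = begin
    ∑² f                        ≤⟨ sumOver-mono rows≤r (allFin n) ⟩
    ∑[ a ∈ allFin n ] r         ≡⟨ sumOver-allFin n (λ _ → r) ⟩
    sumBelow n (λ _ → r)        ≡⟨ sumBelow-const n r ⟩
    n * r                       ∎
    where open ≤-Reasoning

  sumOver-𝟙-vertex : ∀ (x : Fin n) → ∑[ b ∈ allFin n ] 𝟙 (toℕ b ≡ᵇ toℕ x) ≤ 1
  sumOver-𝟙-vertex x = sumOver-𝟙-atMostOne (λ b → toℕ b ≡ᵇ toℕ x) (allFin⁺ n)
    (λ b≡x c≡x → Finₚ.toℕ-injective (trans (≡ᵇ⇒≡ _ _ b≡x) (sym (≡ᵇ⇒≡ _ _ c≡x))))

Pair : ℕ → Set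
Pair n = Fin n × Fin n

sumOver-allPairs : ∀ n (f : Pair n → ℕ) → sumOver f (allPairs n) ≡ ∑² (λ a b → f (a , b))
sumOver-allPairs n f = trans (sumOver-concatMap f (λ a → map (a ,_) (allFin n)) (allFin n))
                             (sumOver-cong (λ a → sumOver-map f (a ,_) (allFin n)) (allFin n))

-- The i-th entry of a tuple is weighed by h i, so that the sum of the weights over all
-- tuples factorises into one sum over pairs per position.
weight : ∀ {A : Set} {j} → (ℕ → A → ℕ) → ℕ → Vec A j → ℕ
weight h i []       = 1
weight h i (x ∷ xs) = h i x * weight h (suc i) xs

sumOver-allTuples-suc : ∀ n j i (h : ℕ → Pair n → ℕ) →
  sumOver (weight h i) (allTuples n (suc j))
    ≡ sumOver (h i) (allPairs n) * sumOver (weight h (suc i)) (allTuples n j)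
sumOver-allTuples-suc n j i h = begin
  sumOver (weight h i) (allTuples n (suc j))
    ≡⟨ sumOver-concatMap (weight h i) (λ p → map (p ∷_) (allTuples n j)) (allPairs n) ⟩
  ∑[ p ∈ allPairs n ] sumOver (weight h i) (map (p ∷_) (allTuples n j))
    ≡⟨ sumOver-cong (λ p → trans (sumOver-map (weight h i) (p ∷_) (allTuples n j))
                                 (sumOver-*ˡ (weight h (suc i)) (h i p) (allTuples n j))) (allPairs n) ⟩
  ∑[ p ∈ allPairs n ] (h i p * sumOver (weight h (suc i)) (allTuples n j))
    ≡⟨ sumOver-*ʳ (h i) _ (allPairs n) ⟩
  sumOver (h i) (allPairs n) * sumOver (weight h (suc i)) (allTuples n j) ∎
  where open ≡-Reasoning

sumOver-allTuples-≤ : ∀ n (h : ℕ → Pair n → ℕ) {E} → (∀ i → sumOver (h i) (allPairs n) ≤ E) →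
                      ∀ j i → sumOver (weight h i) (allTuples n j) ≤ E ^ j
sumOver-allTuples-≤ n h h≤E zero    i = ≤-refl
sumOver-allTuples-≤ n h h≤E (suc j) i rewrite sumOver-allTuples-suc n j i h =
  *-mono-≤ (h≤E i) (sumOver-allTuples-≤ n h h≤E j (suc i))

sumOver-allTuples-≥ : ∀ n (h : ℕ → Pair n → ℕ) {B k} → (∀ i → i < k → B ≤ sumOver (h i) (allPairs n)) →
                      ∀ j i → i + j ≤ k → B ^ j ≤ sumOver (weight h i) (allTuples n j)
sumOver-allTuples-≥ n h B≤h zero    i _     = ≤-refl
sumOver-allTuples-≥ n h {k = k} B≤h (suc j) i i+j<k rewrite sumOver-allTuples-suc n j i h =
  *-mono-≤ (B≤h i (≤-trans (s≤s (m≤m+n i j)) 1+i+j≤k)) (sumOver-allTuples-≥ n h B≤h j (suc i) 1+i+j≤k)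
  where
  1+i+j≤k : suc i + j ≤ k
  1+i+j≤k = subst (_≤ k) (+-suc i j) i+j<k

𝟙-allB : ∀ {A : Set} {j} (f : A → Bool) i (xs : Vec A j) →
         𝟙 (allB f (toList xs)) ≡ weight (λ _ → 𝟙 ∘ f) i xs
𝟙-allB f i []       = refl
𝟙-allB f i (x ∷ xs) = trans (𝟙-∧ (f x) _) (cong (𝟙 (f x) *_) (𝟙-allB f (suc i) xs))

allFromB : ∀ {A : Set} {j} → (ℕ → A → Bool) → ℕ → Vec A j → Bool
allFromB g i []       = true
allFromB g i (x ∷ xs) = g i x ∧ allFromB g (suc i) xs

weight-𝟙 : ∀ {A : Set} {j} (g : ℕ → A → Bool) i (xs : Vec A j) →
           weight (λ i → 𝟙 ∘ g i) i xs ≡ 𝟙 (allFromB g i xs)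
weight-𝟙 g i []       = refl
weight-𝟙 g i (x ∷ xs) = trans (cong (𝟙 (g i x) *_) (weight-𝟙 g (suc i) xs)) (sym (𝟙-∧ (g i x) _))

*-^-distrib : ∀ a b j → (a * b) ^ j ≡ a ^ j * b ^ j
*-^-distrib a b zero    = refl
*-^-distrib a b (suc j) = trans (cong (a * b *_) (*-^-distrib a b j)) (interchange a b (a ^ j) (b ^ j))
  where
  interchange : ∀ a b x y → a * b * (x * y) ≡ a * x * (b * y)
  interchange = solve-∀

≤-twice-quotient : ∀ n d .{{_ : NonZero d}} → d ≤ n → n ≤ (n / d + n / d) * d
≤-twice-quotient n d d≤n = begin
  n                           ≡⟨ m≡m%n+[m/n]*n n d ⟩
  n % d + n / d * d           ≤⟨ +-monoˡ-≤ (n / d * d) (<⇒≤ (m%n<n n d)) ⟩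
  d + n / d * d               ≤⟨ +-monoˡ-≤ (n / d * d) (m≤n*m d (n / d) {{>-nonZero (m≥n⇒m/n>0 d≤n)}}) ⟩
  n / d * d + n / d * d       ≡⟨ sym (*-distribʳ-+ d (n / d) (n / d)) ⟩
  (n / d + n / d) * d         ∎
  where open ≤-Reasoning

module UpperBound {n} (G : Graph n) (col : Colouring n) (proper : Proper G col)
                  (k : ℕ) (noRainbow : NoRainbowMatching k G col) where

  colourOf : Pair n → ℕ
  colourOf p = col (proj₁ p) (proj₂ p)

  Extends : ∀ {ℓ} → Pair n → Vec (Pair n) ℓ → Set
  Extends p R = T (adj G (proj₁ p) (proj₂ p))
              × T (allB (disjointB p) (toList R))
              × T (allB (λ q → not (colourOf p ≡ᵇ colourOf q)) (toList R))

  extends? : ∀ {ℓ} p (R : Vec (Pair n) ℓ) → Dec (Extends p R)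
  extends? p R = T? _ ×-dec T? _ ×-dec T? _

  RainbowMatching : ∀ {ℓ} → Vec (Pair n) ℓ → Set
  RainbowMatching R = T (matchingB G R) × T (rainbowB col R)

  extend : ∀ {ℓ} p (R : Vec (Pair n) ℓ) → Extends p R → RainbowMatching R → RainbowMatching (p ∷ R)
  extend p R (edge , disjoint , newColour) (matching , rainbow) =
      from T-∧ (from T-∧ (edge , proj₁ R-matching) , from T-∧ (disjoint , proj₂ R-matching))
    , from T-∧ (newColour , rainbow)
    where
    R-matching : T (allEdgesB G R) × T (pairwiseB disjointB R)
    R-matching = to T-∧ matching

  record Saturated : Set where
    field
      size      : ℕ
      size<k    : size < k
      edges     : Vec (Pair n) size
      saturated : ∀ a b → ¬ Extends (a , b) edges

  saturate : ∀ j {ℓ} (R : Vec (Pair n) ℓ) → ℓ + j ≡ k → RainbowMatching R → Saturated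
  saturate zero {ℓ} R ℓ+0≡k rainbow with trans (sym (+-identityʳ ℓ)) ℓ+0≡k
  ... | refl = ⊥-elim (noRainbow (R , rainbow))
  saturate (suc j) {ℓ} R ℓ+j≡k rainbow with Finₚ.any? (λ a → Finₚ.any? (λ b → extends? (a , b) R))
  ... | yes (a , b , ab-extends) =
    saturate j ((a , b) ∷ R) (trans (sym (+-suc ℓ j)) ℓ+j≡k) (extend (a , b) R ab-extends rainbow)
  ... | no stuck = record
    { size = ℓ ; size<k = subst (ℓ <_) ℓ+j≡k (m<m+n ℓ (s≤s z≤n)) ; edges = R
    ; saturated = λ a b ab-extends → stuck (a , b , ab-extends) }

  ends : Pair n → Fin n → ℕ
  ends q v = 𝟙 (toℕ v ≡ᵇ toℕ (proj₁ q)) + 𝟙 (toℕ v ≡ᵇ toℕ (proj₂ q))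

  sameColour : Pair n → Fin n → Fin n → ℕ
  sameColour q a b = 𝟙 (adj G a b ∧ (col a b ≡ᵇ colourOf q))

  blocks : Pair n → Fin n → Fin n → ℕ
  blocks q a b = (ends q a + ends q b) + sameColour q a b

  edge-blocked : (S : Saturated) → ∀ a b → 𝟙 (adj G a b) ≤ ∑[ q ∈ toList (Saturated.edges S) ] blocks q a b
  edge-blocked S a b with adj G a b in ab
  ... | false = z≤n
  ... | true  = ≤-trans (sumOver-violations (disjointB (a , b)) (λ q → not (col a b ≡ᵇ colourOf q)) R stuck)
                        (sumOver-mono (λ q → +-mono-≤ (touching q) (≤-reflexive (cong 𝟙 (not-involutive _)))) R)
    where
    R : List (Pair n)
    R = toList (Saturated.edges S)
    stuck : ¬ (T (allB (disjointB (a , b)) R) × T (allB (λ q → not (col a b ≡ᵇ colourOf q)) R))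
    stuck = λ (disjoint , newColour) → Saturated.saturated S a b (subst T (sym ab) tt , disjoint , newColour)
    touching : ∀ q → 𝟙 (not (disjointB (a , b) q)) ≤ ends q a + ends q b
    touching (c , d) = 𝟙-not-∧-not (toℕ a ≡ᵇ toℕ c) (toℕ a ≡ᵇ toℕ d) (toℕ b ≡ᵇ toℕ c) (toℕ b ≡ᵇ toℕ d)

  sumOver-sameColour : ∀ γ a → ∑[ b ∈ allFin n ] 𝟙 (adj G a b ∧ (col a b ≡ᵇ γ)) ≤ 1
  sumOver-sameColour γ a = sumOver-𝟙-atMostOne _ (allFin⁺ n) same-edge
    where
    same-edge : ∀ {b c} → T (adj G a b ∧ (col a b ≡ᵇ γ)) → T (adj G a c ∧ (col a c ≡ᵇ γ)) → b ≡ c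
    same-edge {b} {c} ab ac with b Finₚ.≟ c
    ... | yes b≡c = b≡c
    ... | no b≢c  = ⊥-elim (proj₂ proper a b c (to T-≡ (proj₁ (to T-∧ ab))) (to T-≡ (proj₁ (to T-∧ ac))) b≢c
                             (trans (≡ᵇ⇒≡ _ _ (proj₂ (to T-∧ ab))) (sym (≡ᵇ⇒≡ _ _ (proj₂ (to T-∧ ac))))))

  sumOver-ends : ∀ q → sumOver (ends q) (allFin n) ≤ 2
  sumOver-ends (c , d) = begin
    sumOver (ends (c , d)) (allFin n)
      ≡⟨ sumOver-+ _ _ (allFin n) ⟩
    ∑[ v ∈ allFin n ] 𝟙 (toℕ v ≡ᵇ toℕ c) + ∑[ v ∈ allFin n ] 𝟙 (toℕ v ≡ᵇ toℕ d)
                                                          ≤⟨ +-mono-≤ (sumOver-𝟙-vertex c) (sumOver-𝟙-vertex d) ⟩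
    2 ∎
    where open ≤-Reasoning

  ∑²-blocks : ∀ q → ∑² (blocks q) ≤ 5 * n
  ∑²-blocks q = begin
    ∑² (blocks q)             ≤⟨ ∑²-+-≤ (λ a b → ends q a + ends q b) (sameColour q)
                                   (∑²-+-≤ (λ a _ → ends q a) (λ _ b → ends q b) tails heads)
                                   (∑²-rows≤ (sameColour q) (sumOver-sameColour (colourOf q))) ⟩
    (n * 2 + n * 2) + n * 1   ≡⟨ five-n n ⟩
    5 * n                     ∎
    where
    open ≤-Reasoning
    tails : ∑² (λ a _ → ends q a) ≤ n * 2
    tails rewrite ∑²-transpose (λ a _ → ends q a) = ∑²-rows≤ (λ _ b → ends q b) (λ _ → sumOver-ends q)
    heads : ∑² (λ _ b → ends q b) ≤ n * 2
    heads = ∑²-rows≤ (λ _ b → ends q b) (λ _ → sumOver-ends q)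
    five-n : ∀ n → (n * 2 + n * 2) + n * 1 ≡ 5 * n
    five-n = solve-∀

  edgeCount : ℕ
  edgeCount = ∑[ p ∈ allPairs n ] 𝟙 (adj G (proj₁ p) (proj₂ p))

  edgeCount-≤ : edgeCount ≤ k * (5 * n)
  edgeCount-≤ = begin
    edgeCount
      ≡⟨ sumOver-allPairs n _ ⟩
    ∑² (λ a b → 𝟙 (adj G a b))
      ≤⟨ sumOver-mono (λ a → sumOver-mono (edge-blocked S a) (allFin n)) (allFin n) ⟩
    ∑[ a ∈ allFin n ] ∑[ b ∈ allFin n ] ∑[ q ∈ R ] blocks q a b
      ≡⟨ sumOver-cong (λ a → sumOver-comm (λ b q → blocks q a b) (allFin n) R) (allFin n) ⟩
    ∑[ a ∈ allFin n ] ∑[ q ∈ R ] ∑[ b ∈ allFin n ] blocks q a b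
      ≡⟨ sumOver-comm _ (allFin n) R ⟩
    ∑[ q ∈ R ] ∑² (blocks q)
      ≤⟨ sumOver-mono ∑²-blocks R ⟩
    ∑[ q ∈ R ] (5 * n)
      ≡⟨ sumOver-toList-const (5 * n) (Saturated.edges S) ⟩
    Saturated.size S * (5 * n)
      ≤⟨ *-monoˡ-≤ (5 * n) (<⇒≤ (Saturated.size<k S)) ⟩
    k * (5 * n) ∎
    where
    open ≤-Reasoning
    S : Saturated
    S = saturate k [] refl (tt , tt)
    R : List (Pair n)
    R = toList (Saturated.edges S)

  copies-≤ : copiesMatching k G ≤ (k * 5) ^ k * n ^ k
  copies-≤ = begin
    copiesMatching k G
      ≡⟨ sum-map _ (allTuples n k) ⟩
    ∑[ m ∈ allTuples n k ] 𝟙 (matchingB G m ∧ canonicalB m)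
      ≤⟨ sumOver-mono tuple-edges (allTuples n k) ⟩
    sumOver (weight (λ _ p → 𝟙 (adj G (proj₁ p) (proj₂ p))) 0) (allTuples n k)
      ≤⟨ sumOver-allTuples-≤ n _ (λ _ → ≤-refl) k 0 ⟩
    edgeCount ^ k
      ≤⟨ ^-monoˡ-≤ k edgeCount-≤ ⟩
    (k * (5 * n)) ^ k
      ≡⟨ cong (_^ k) (sym (*-assoc k 5 n)) ⟩
    (k * 5 * n) ^ k
      ≡⟨ *-^-distrib (k * 5) n k ⟩
    (k * 5) ^ k * n ^ k ∎
    where
    open ≤-Reasoning
    tuple-edges : ∀ m → 𝟙 (matchingB G m ∧ canonicalB m) ≤ weight (λ _ p → 𝟙 (adj G (proj₁ p) (proj₂ p))) 0 m
    tuple-edges m = ≤-trans (𝟙-mono (proj₁ ∘ to T-∧ ∘ proj₁ ∘ to T-∧))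
                            (≤-reflexive (𝟙-allB (λ p → adj G (proj₁ p) (proj₂ p)) 0 m))

monochromatic-noRainbow : ∀ {n} (G : Graph n) {k} → 1 < k → NoRainbowMatching k G (λ _ _ → 0)
monochromatic-noRainbow G (s≤s (s≤s z≤n)) ((p ∷ q ∷ m) , _ , ())

module Ladder (n D : ℕ) (0<D : 0 < D) where

  rung : Fin n → Fin n → Bool
  rung a b = (toℕ a <ᵇ D) ∧ (toℕ a + D ≡ᵇ toℕ b)

  IsRung : Pair n → Set
  IsRung (a , b) = toℕ a < D × toℕ b ≡ toℕ a + D

  rung⇒IsRung : ∀ {a b} → T (rung a b) → IsRung (a , b)
  rung⇒IsRung t = <ᵇ⇒< _ _ (proj₁ (to T-∧ t)) , sym (≡ᵇ⇒≡ _ _ (proj₂ (to T-∧ t)))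

  rung-irrefl : ∀ a → rung a a ≡ false
  rung-irrefl a = ¬T⇒≡false (λ t → <⇒≢ (m<m+n (toℕ a) 0<D) (proj₂ (rung⇒IsRung t)))

  G : Graph n
  G = record
    { adj        = λ a b → rung a b ∨ rung b a
    ; adj-sym    = λ a b → ∨-comm (rung a b) (rung b a)
    ; adj-irrefl = λ a → cong₂ _∨_ (rung-irrefl a) (rung-irrefl a)
    }

  col : Colouring n
  col _ _ = 0

  adj⇒IsRung : ∀ {a b} → adj G a b ≡ true → IsRung (a , b) ⊎ IsRung (b , a)
  adj⇒IsRung {a} {b} ab with to T-∨ (subst T (sym ab) tt)
  ... | inj₁ t = inj₁ (rung⇒IsRung t)
  ... | inj₂ t = inj₂ (rung⇒IsRung t)

  proper : Proper G col
  proper = (λ _ _ _ → refl) , atMostOneNeighbour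
    where
    top-not-bottom : ∀ {u w} → u < D → u ≡ w + D → ⊥
    top-not-bottom u<D u≡w+D = <⇒≱ u<D (subst (D ≤_) (sym u≡w+D) (m≤n+m D _))
    atMostOneNeighbour : ∀ u v w → adj G u v ≡ true → adj G u w ≡ true → v ≢ w → 0 ≢ 0
    atMostOneNeighbour u v w uv uw v≢w _ with adj⇒IsRung uv | adj⇒IsRung uw
    ... | inj₁ (_ , v≡u+D) | inj₁ (_ , w≡u+D) = v≢w (Finₚ.toℕ-injective (trans v≡u+D (sym w≡u+D)))
    ... | inj₁ (u<D , _)   | inj₂ (_ , u≡w+D) = top-not-bottom u<D u≡w+D
    ... | inj₂ (_ , u≡v+D) | inj₁ (u<D , _)   = top-not-bottom u<D u≡v+D
    ... | inj₂ (_ , u≡v+D) | inj₂ (_ , u≡w+D) =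
      v≢w (Finₚ.toℕ-injective (+-cancelʳ-≡ D _ _ (trans (sym u≡v+D) u≡w+D)))

  Rungs : ∀ {j} → ℕ → Vec (Pair n) j → Set
  Rungs lo []      = ⊤
  Rungs lo (p ∷ m) = lo ≤ toℕ (proj₁ p) × IsRung p × Rungs (suc (toℕ (proj₁ p))) m

  Rungs-weaken : ∀ {j l l′} (m : Vec (Pair n) j) → l′ ≤ l → Rungs l m → Rungs l′ m
  Rungs-weaken []      _    _                       = tt
  Rungs-weaken (p ∷ m) l′≤l (l≤p , p-rung , m-rungs) = ≤-trans l′≤l l≤p , p-rung , m-rungs

  Rungs-allB : ∀ {j} (P : Pair n → Bool) lo → (∀ q → lo ≤ toℕ (proj₁ q) → IsRung q → T (P q)) →
               (m : Vec (Pair n) j) → Rungs lo m → T (allB P (toList m))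
  Rungs-allB P lo P-holds []      _                         = tt
  Rungs-allB P lo P-holds (q ∷ m) (lo≤q , q-rung , m-rungs) =
    from T-∧ ( P-holds q lo≤q q-rung
             , Rungs-allB P _ (λ q′ q<q′ → P-holds q′ (≤-trans lo≤q (≤-trans (n≤1+n _) q<q′))) m m-rungs)

  Rungs-pairwiseB : ∀ {j} (R : Pair n → Pair n → Bool) →
                    (∀ p q → IsRung p → IsRung q → toℕ (proj₁ p) < toℕ (proj₁ q) → T (R p q)) →
                    ∀ lo (m : Vec (Pair n) j) → Rungs lo m → T (pairwiseB R m)
  Rungs-pairwiseB R R-holds lo []      _                        = tt
  Rungs-pairwiseB R R-holds lo (p ∷ m) (_ , p-rung , m-rungs) =
    from T-∧ ( Rungs-allB (R p) _ (λ q p<q q-rung → R-holds p q p-rung q-rung p<q) m m-rungs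
             , Rungs-pairwiseB R R-holds _ m m-rungs)

  rungs-disjoint : ∀ p q → IsRung p → IsRung q → toℕ (proj₁ p) < toℕ (proj₁ q) → T (disjointB p q)
  rungs-disjoint (a , b) (c , d) (a<D , b≡a+D) (c<D , d≡c+D) a<c =
    from T-∧ (distinct (<⇒≢ a<c) , from T-∧ (distinct (<⇒≢ a<d) ,
      from T-∧ (distinct (≢-sym (<⇒≢ c<b)) , distinct (<⇒≢ b<d))))
    where
    distinct : ∀ {x y} → x ≢ y → T (not (x ≡ᵇ y))
    distinct {x} {y} x≢y with x ≡ᵇ y in x≡ᵇy
    ... | false = tt
    ... | true  = x≢y (≡ᵇ⇒≡ x y (subst T (sym x≡ᵇy) tt))
    a<d = subst (toℕ a <_) (sym d≡c+D) (<-≤-trans a<D (m≤n+m D (toℕ c)))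
    c<b = subst (toℕ c <_) (sym b≡a+D) (<-≤-trans c<D (m≤n+m D (toℕ a)))
    b<d = subst₂ _<_ (sym b≡a+D) (sym d≡c+D) (+-monoˡ-< D a<c)

  Rungs⇒canonicalMatching : ∀ {j} lo (m : Vec (Pair n) j) → Rungs lo m → T (matchingB G m ∧ canonicalB m)
  Rungs⇒canonicalMatching lo m m-rungs =
    from T-∧ ( from T-∧ ( Rungs-allB _ lo (λ q _ → is-edge q) m m-rungs
                        , Rungs-pairwiseB disjointB rungs-disjoint lo m m-rungs)
             , from T-∧ ( Rungs-allB _ lo (λ q _ q-rung → <⇒<ᵇ (lower<upper q q-rung)) m m-rungs
                        , Rungs-pairwiseB _ (λ _ _ _ _ p<q → <⇒<ᵇ p<q) lo m m-rungs))
    where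
    is-edge : ∀ q → IsRung q → T (adj G (proj₁ q) (proj₂ q))
    is-edge (a , b) (a<D , b≡a+D) = from T-∨ (inj₁ (from T-∧ (<⇒<ᵇ a<D , ≡⇒≡ᵇ _ _ (sym b≡a+D))))
    lower<upper : ∀ q → IsRung q → toℕ (proj₁ q) < toℕ (proj₂ q)
    lower<upper (a , b) (_ , b≡a+D) = subst (toℕ a <_) (sym b≡a+D) (m<m+n (toℕ a) 0<D)

module LadderCount (n k B : ℕ) (0<k : 0 < k) (0<B : 0 < B) (2D≤n : k * B + k * B ≤ n) where

  D : ℕ
  D = k * B

  open Ladder n D (*-mono-≤ 0<k 0<B) public

  inBlock : ℕ → ℕ → Bool
  inBlock i x = (i * B ≤ᵇ x) ∧ (x <ᵇ suc i * B)

  blockRung : ℕ → Pair n → Bool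
  blockRung i p = inBlock i (toℕ (proj₁ p)) ∧ (toℕ (proj₁ p) + D ≡ᵇ toℕ (proj₂ p))

  block-end≤D : ∀ {i} → i < k → suc i * B ≤ D
  block-end≤D i<k = *-monoˡ-≤ B i<k

  blockRung⇒IsRung : ∀ {i} p → i < k → T (blockRung i p) →
                     i * B ≤ toℕ (proj₁ p) × toℕ (proj₁ p) < suc i * B × IsRung p
  blockRung⇒IsRung {i} p i<k p-block-rung =
    ≤ᵇ⇒≤ _ _ (proj₁ in-block) , p<end ,
    <-≤-trans p<end (block-end≤D i<k) , sym (≡ᵇ⇒≡ _ _ (proj₂ (to T-∧ p-block-rung)))
    where
    in-block : T (i * B ≤ᵇ toℕ (proj₁ p)) × T (toℕ (proj₁ p) <ᵇ suc i * B)
    in-block = to T-∧ (proj₁ (to T-∧ p-block-rung))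
    p<end : toℕ (proj₁ p) < suc i * B
    p<end = <ᵇ⇒< _ _ (proj₂ in-block)

  allFromB-blockRung⇒Rungs : ∀ j i (m : Vec (Pair n) j) → i + j ≤ k →
                             T (allFromB blockRung i m) → Rungs (i * B) m
  allFromB-blockRung⇒Rungs zero    i []      _     _         = tt
  allFromB-blockRung⇒Rungs (suc j) i (p ∷ m) i+j<k in-blocks =
    proj₁ placed , proj₂ (proj₂ placed) ,
    Rungs-weaken m (proj₁ (proj₂ placed))
      (allFromB-blockRung⇒Rungs j (suc i) m 1+i+j≤k (proj₂ (to T-∧ in-blocks)))
    where
    1+i+j≤k : suc i + j ≤ k
    1+i+j≤k = subst (_≤ k) (+-suc i j) i+j<k
    placed : i * B ≤ toℕ (proj₁ p) × toℕ (proj₁ p) < suc i * B × IsRung p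
    placed = blockRung⇒IsRung p (≤-trans (s≤s (m≤m+n i j)) 1+i+j≤k) (proj₁ (to T-∧ in-blocks))

  blockRung-count : ∀ i → i < k → B ≤ ∑[ p ∈ allPairs n ] 𝟙 (blockRung i p)
  blockRung-count i i<k = begin
    B
      ≤⟨ sumBelow-interval n (i * B) B _ block⊆ rung-from ⟩
    sumBelow n (λ x → sumBelow n (λ y → 𝟙 (inBlock i x ∧ (x + D ≡ᵇ y))))
      ≡⟨ sym (sumOver-allFin n _) ⟩
    ∑[ a ∈ allFin n ] sumBelow n (λ y → 𝟙 (inBlock i (toℕ a) ∧ (toℕ a + D ≡ᵇ y)))
      ≡⟨ sym (sumOver-cong (λ a → sumOver-allFin n _) (allFin n)) ⟩
    ∑² (λ a b → 𝟙 (blockRung i (a , b)))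
      ≡⟨ sym (sumOver-allPairs n _) ⟩
    ∑[ p ∈ allPairs n ] 𝟙 (blockRung i p) ∎
    where
    open ≤-Reasoning
    block⊆ : i * B + B ≤ n
    block⊆ = ≤-trans (≤-reflexive (+-comm (i * B) B)) (≤-trans (block-end≤D i<k) (≤-trans (m≤m+n D D) 2D≤n))
    rung-from : ∀ j → j < B → 1 ≤ sumBelow n (λ y → 𝟙 (inBlock i (i * B + j) ∧ (i * B + j + D ≡ᵇ y)))
    rung-from j j<B = ≤-trans (≤-reflexive (sym (T⇒𝟙≡1 (from T-∧ (in-block , ≡⇒≡ᵇ (x + D) (x + D) refl)))))
                              (sumBelow-term n _ x+D<n)
      where
      x : ℕ
      x = i * B + j
      x<end : x < suc i * B
      x<end = subst (x <_) (+-comm (i * B) B) (+-monoʳ-< (i * B) j<B)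
      in-block : T (inBlock i x)
      in-block = from T-∧ (≤⇒≤ᵇ (m≤m+n (i * B) j) , <⇒<ᵇ x<end)
      x+D<n : x + D < n
      x+D<n = ≤-trans (+-monoˡ-≤ D (<-≤-trans x<end (block-end≤D i<k))) 2D≤n

  copies-≥ : B ^ k ≤ copiesMatching k G
  copies-≥ = begin
    B ^ k
      ≤⟨ sumOver-allTuples-≥ n (λ i p → 𝟙 (blockRung i p)) blockRung-count k 0 ≤-refl ⟩
    sumOver (weight (λ i p → 𝟙 (blockRung i p)) 0) (allTuples n k)
      ≤⟨ sumOver-mono block-tuple (allTuples n k) ⟩
    ∑[ m ∈ allTuples n k ] 𝟙 (matchingB G m ∧ canonicalB m)
      ≡⟨ sym (sum-map _ (allTuples n k)) ⟩
    copiesMatching k G ∎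
    where
    open ≤-Reasoning
    block-tuple : ∀ m → weight (λ i p → 𝟙 (blockRung i p)) 0 m ≤ 𝟙 (matchingB G m ∧ canonicalB m)
    block-tuple m = ≤-trans (≤-reflexive (weight-𝟙 blockRung 0 m))
                            (𝟙-mono (Rungs⇒canonicalMatching 0 m ∘ allFromB-blockRung⇒Rungs k 0 m ≤-refl))

ladder-lowerBound : ∀ k n → 1 < k → 2 * k ≤ n →
  Σ (Graph n) λ G → Σ (Colouring n) λ col →
    Proper G col × NoRainbowMatching k G col × (n ^ k ≤ (4 * k) ^ k * copiesMatching k G)
-- Matching on 1 < k exposes k = 2 + _, which makes 2 * k visibly nonzero for _/_.
ladder-lowerBound k n 1<k@(s≤s (s≤s z≤n)) 2k≤n = G , col , proper , monochromatic-noRainbow G 1<k , n^k≤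
  where
  B : ℕ
  B = n / (2 * k)
  2D≤n : k * B + k * B ≤ n
  2D≤n = subst (_≤ n) (B*2k≡2kB k B) (m/n*n≤m n (2 * k))
    where
    B*2k≡2kB : ∀ k B → B * (2 * k) ≡ k * B + k * B
    B*2k≡2kB = solve-∀
  open LadderCount n k B (s≤s z≤n) (m≥n⇒m/n>0 2k≤n) 2D≤n
  n^k≤ : n ^ k ≤ (4 * k) ^ k * copiesMatching k G
  n^k≤ = begin
    n ^ k
      ≤⟨ ^-monoˡ-≤ k (≤-trans (≤-twice-quotient n (2 * k) 2k≤n) (≤-reflexive ([B+B]*2k≡4kB k B))) ⟩
    ((4 * k) * B) ^ k
      ≡⟨ *-^-distrib (4 * k) B k ⟩
    (4 * k) ^ k * B ^ k
      ≤⟨ *-monoʳ-≤ ((4 * k) ^ k) copies-≥ ⟩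
    (4 * k) ^ k * copiesMatching k G ∎
    where
    open ≤-Reasoning
    [B+B]*2k≡4kB : ∀ k B → (B + B) * (2 * k) ≡ 4 * k * B
    [B+B]*2k≡4kB = solve-∀

proposition4p4 : ∀ (k : ℕ) → 1 < k →
    Σ ℕ λ c → Σ ℕ λ C → Σ ℕ λ N → ∀ (n : ℕ) → N ≤ n →
      ((G : Graph n) (col : Colouring n) → Proper G col → NoRainbowMatching k G col →
        copiesMatching k G ≤ C * n ^ k)
      ×
      Σ (Graph n) (λ G → Σ (Colouring n) (λ col →
        Proper G col × NoRainbowMatching k G col × (n ^ k ≤ c * copiesMatching k G)))
proposition4p4 k 1<k = (4 * k) ^ k , (k * 5) ^ k , 2 * k , λ n 2k≤n →
    (λ G col proper noRainbow → UpperBound.copies-≤ G col proper k noRainbow)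
  , ladder-lowerBound k n 1<k 2k≤n
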